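{- Let $Q$ be a stream of length $K$ of elements of $[n]$, and let $f_l$ denote the number of occurrences of $l$ in $Q$. Let $\lambda\in(0,1]$ and $T>0$. Let $h:[n]\to\{0,1\}$ be a random pairwise independent hash function with $P(h(i)=1)=\lambda$ for every $i$. Let the pool $\Gamma$ be the subsequence of $Q$ consisting of all stream items $q$ with $h(q)=1$, and let $L$ be an element chosen uniformly at random among the positions of $\Gamma$ (independently given $h$). Let $B_1$ be the event that $1\in\Gamma$ and $A$ the event that $L\neq 1$. If $f_1\ge \lambda T K$, then $P(A\mid B_1)\le 2T^{ -1/2}$.
   Formalization: The parameters λ and T are rational, and the random hash function h takes each of its values with a rational probability. -}

module Defs where

open import Data.Nat as ℕ using (ℕ; zero; suc)
open import Data.Integer using (+_)
open import Data.Fin as Fin using (Fin)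
open import Data.Bool using (Bool; true; false; if_then_else_; _∧_; not)
open import Data.List using (List; length; filterᵇ)
open import Data.Bool.ListAction using (any)
open import Data.Rational using (ℚ; 0ℚ; 1ℚ; _+_; _*_; _÷_; _/_; ≢-nonZero)
open import Data.Rational.Properties using (_≟_)
open import Relation.Nullary using (does; yes; no)
open import Relation.Binary.PropositionalEquality using (_≡_; _≢_)

-- The universe [n] = {1,…,n} is modelled as Fin N; the distinguished
-- element "1" is Fin.zero (so N = suc n, i.e. n ≥ 1).

ℕtoℚ : ℕ → ℚ
ℕtoℚ k = (+ k) / 1

Σ : (m : ℕ) → (Fin m → ℚ) → ℚ
Σ zero    f = 0ℚ
Σ (suc m) f = f Fin.zero + Σ m (λ j → f (Fin.suc j))

_==ᵇ_ : Bool → Bool → Bool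
true  ==ᵇ b = b
false ==ᵇ b = not b

_=F_ : ∀ {N} → Fin N → Fin N → Bool
x =F y = does (x Fin.≟ y)

freq : ∀ {N} → List (Fin N) → Fin N → ℕ
freq Q l = length (filterᵇ (_=F l) Q)

-- A (finitely supported, rational-weighted) probability distribution on
-- hash functions h : [N] → {0,1}: outcome j has probability weight j
-- and yields hash function hash j.
record HashDist (N : ℕ) : Set where
  field
    m        : ℕ
    weight   : Fin m → ℚ
    hash     : Fin m → Fin N → Bool
    weight≥0 : ∀ j → 0ℚ Data.Rational.≤ weight j
    weight-sum : Σ m weight ≡ 1ℚ
open HashDist public

Pr : ∀ {N} → HashDist N → ((Fin N → Bool) → Bool) → ℚ
Pr D E = Σ (m D) (λ j → if E (hash D j) then weight D j else 0ℚ)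

Ex : ∀ {N} → HashDist N → ((Fin N → Bool) → ℚ) → ℚ
Ex D φ = Σ (m D) (λ j → weight D j * φ (hash D j))

HasMarginal : ∀ {N} → HashDist N → ℚ → Set
HasMarginal {N} D λ' = ∀ (i : Fin N) → Pr D (λ h → h i) ≡ λ'

PairwiseIndependent : ∀ {N} → HashDist N → Set
PairwiseIndependent {N} D =
  ∀ (i i' : Fin N) → i ≢ i' → ∀ (b b' : Bool) →
    Pr D (λ h → (h i ==ᵇ b) ∧ (h i' ==ᵇ b'))
      ≡ Pr D (λ h → h i ==ᵇ b) * Pr D (λ h → h i' ==ᵇ b')

pool : ∀ {N} → (Fin N → Bool) → List (Fin N) → List (Fin N)
pool h Q = filterᵇ h Q

-- ratio a/s of naturals (0 if s = 0; only used when s > 0)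
ratio : ℕ → ℕ → ℚ
ratio a zero    = 0ℚ
ratio a (suc s) = (+ a) / suc s

B₁ : ∀ {n} → List (Fin (suc n)) → (Fin (suc n) → Bool) → Bool
B₁ Q h = any (_=F Fin.zero) (pool h Q)

-- P(A | h): L is a uniformly random position of Γ, A is the event that
-- the item at position L is not 1
PrAgiven : ∀ {n} → List (Fin (suc n)) → (Fin (suc n) → Bool) → ℚ
PrAgiven Q h =
  ratio (length (filterᵇ (λ q → not (q =F Fin.zero)) (pool h Q)))
        (length (pool h Q))

PrAandB₁ : ∀ {n} → HashDist (suc n) → List (Fin (suc n)) → ℚ
PrAandB₁ D Q = Ex D (λ h → if B₁ Q h then PrAgiven Q h else 0ℚ)

-- conditional probability P(X | Y) = P(X ∩ Y) / P(Y)  (0 if P(Y) = 0)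
condDiv : ℚ → ℚ → ℚ
condDiv x y with y ≟ 0ℚ
... | yes _  = 0ℚ
... | no y≢0 = _÷_ x y {{≢-nonZero y≢0}}

PrA∣B₁ : ∀ {n} → HashDist (suc n) → List (Fin (suc n)) → ℚ
PrA∣B₁ D Q = condDiv (PrAandB₁ D Q) (Pr D (B₁ Q))

{-# OPTIONS --safe #-}
-- If 1 does not occur in Q, then B₁ is empty and P(A | B₁) = 0. Otherwise B₁ is the event
-- h(1) = 1, of probability λ. Given such an h, the pool consists of the F = f₁ copies of 1
-- and of a(h) other items, so P(A | h) = a(h)/(F + a(h)) lies in [0, 1] and is at most
-- a(h)/F. By pairwise independence each of the G = K − F items different from 1 is pooled
-- together with 1 with probability λ², so E[h(1)·a(h)] = λ²G. Hence
-- P(A | B₁) ≤ min(1, λG/F) ≤ min(1, 1/T) because λTK ≤ F, and P(A | B₁)²·T ≤ 1.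
module Submission where

open import Defs
open import Data.Nat using (ℕ; suc)
open import Data.Fin using (Fin; zero)
import Data.Fin as Fin
open import Data.List using (List; length)
open import Data.Rational using (ℚ; 0ℚ; 1ℚ; _*_; _≤_; _<_)
open import Data.Integer using (+_)
open import Data.Rational using (_/_)

import Data.Nat as ℕ
import Data.Nat.Properties as ℕ
import Data.Integer as ℤ
import Data.Integer.Properties as ℤ
open import Data.Integer.Solver using () renaming (module +-*-Solver to ℤ-Solver)
open import Data.Rational using (_+_; toℚᵘ; positive; nonNegative; ≢-nonZero; 1/_)
open import Data.Rational.Properties
open import Data.Rational.Solver using (module +-*-Solver)
import Data.Rational.Unnormalised as ℚᵘ
import Data.Rational.Unnormalised.Properties as ℚᵘ
open import Algebra.Bundles using (CommutativeMonoid)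
open import Algebra.Properties.CommutativeSemigroup
  (CommutativeMonoid.commutativeSemigroup +-0-commutativeMonoid) using (interchange)
open import Data.Bool using (Bool; true; false; if_then_else_; _∧_; not; T?)
open import Data.Bool.Properties using (if-eta; ∧-zeroʳ; ∧-identityʳ)
open import Data.Bool.ListAction using (any)
open import Data.List using ([]; _∷_; filterᵇ)
open import Data.List.Properties using (length-filter)
open import Data.Unit using (tt)
open import Data.Empty using (⊥-elim)
open import Function using (_∘_)
open import Relation.Binary.PropositionalEquality
open import Relation.Nullary using (yes; no)

-- Rational arithmetic

-- ℚ's _/_ normalises by a gcd, so identities between fractions are checked on unnormalised representatives.
toℚᵘ-/ : ∀ a s → toℚᵘ ((+ a) / suc s) ℚᵘ.≃ ℚᵘ.mkℚᵘ (+ a) s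
toℚᵘ-/ a s = toℚᵘ-fromℚᵘ (ℚᵘ.mkℚᵘ (+ a) s)

ℕtoℚ-+ : ∀ a b → ℕtoℚ (a ℕ.+ b) ≡ ℕtoℚ a + ℕtoℚ b
ℕtoℚ-+ a b = toℚᵘ-injective (begin
  toℚᵘ (ℕtoℚ (a ℕ.+ b))                 ≈⟨ toℚᵘ-/ (a ℕ.+ b) 0 ⟩
  ℚᵘ.mkℚᵘ (+ (a ℕ.+ b)) 0               ≈⟨ ℚᵘ.*≡* (trans (cong (ℤ._* + 1) (ℤ.pos-+ a b)) (sum-over-one (+ a) (+ b))) ⟩
  ℚᵘ.mkℚᵘ (+ a) 0 ℚᵘ.+ ℚᵘ.mkℚᵘ (+ b) 0  ≈⟨ ℚᵘ.+-cong (toℚᵘ-/ a 0) (toℚᵘ-/ b 0) ⟨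
  toℚᵘ (ℕtoℚ a) ℚᵘ.+ toℚᵘ (ℕtoℚ b)      ≈⟨ toℚᵘ-homo-+ (ℕtoℚ a) (ℕtoℚ b) ⟨
  toℚᵘ (ℕtoℚ a + ℕtoℚ b)                ∎)
  where
  open ℚᵘ.≃-Reasoning
  open ℤ-Solver
  sum-over-one : ∀ x y → (x ℤ.+ y) ℤ.* + 1 ≡ (x ℤ.* + 1 ℤ.+ y ℤ.* + 1) ℤ.* + 1
  sum-over-one = solve 2 (λ x y → (x :+ y) :* con (+ 1) := (x :* con (+ 1) :+ y :* con (+ 1)) :* con (+ 1)) refl

ℕtoℚ-nonNeg : ∀ a → 0ℚ ≤ ℕtoℚ a
ℕtoℚ-nonNeg a = nonNegative⁻¹ (ℕtoℚ a) {{normalize-nonNeg a 1}}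

ℕtoℚ-pos : ∀ {a} → 0 ℕ.< a → 0ℚ < ℕtoℚ a
ℕtoℚ-pos {suc a} _ = positive⁻¹ (ℕtoℚ (suc a)) {{normalize-pos (suc a) 1}}

ratio-nonNeg : ∀ a s → 0ℚ ≤ ratio a s
ratio-nonNeg a ℕ.zero  = ≤-refl
ratio-nonNeg a (suc s) = nonNegative⁻¹ (ratio a (suc s)) {{normalize-nonNeg a (suc s)}}

ratio-*-denominator : ∀ a s → ratio a (suc s) * ℕtoℚ (suc s) ≡ ℕtoℚ a
ratio-*-denominator a s = toℚᵘ-injective (begin
  toℚᵘ (ratio a (suc s) * ℕtoℚ (suc s))            ≈⟨ toℚᵘ-homo-* (ratio a (suc s)) (ℕtoℚ (suc s)) ⟩
  toℚᵘ (ratio a (suc s)) ℚᵘ.* toℚᵘ (ℕtoℚ (suc s))  ≈⟨ ℚᵘ.*-cong (toℚᵘ-/ a s) (toℚᵘ-/ (suc s) 0) ⟩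
  ℚᵘ.mkℚᵘ (+ a) s ℚᵘ.* ℚᵘ.mkℚᵘ (+ suc s) 0          ≈⟨ ℚᵘ.*≡* (trans (ℤ.*-identityʳ _) (cong (λ d → + a ℤ.* + d) (sym (ℕ.*-identityʳ (suc s))))) ⟩
  ℚᵘ.mkℚᵘ (+ a) 0                                   ≈⟨ toℚᵘ-/ a 0 ⟨
  toℚᵘ (ℕtoℚ a)                                     ∎)
  where open ℚᵘ.≃-Reasoning

ratio-* : ∀ {a s} → a ℕ.≤ s → ratio a s * ℕtoℚ s ≡ ℕtoℚ a
ratio-* {s = ℕ.zero} ℕ.z≤n = refl
ratio-* {a} {suc s} _     = ratio-*-denominator a s

p≤p+q : ∀ p {q} → 0ℚ ≤ q → p ≤ p + q
p≤p+q p {q} 0≤q = ≤-trans (≤-reflexive (sym (+-identityʳ p))) (+-monoʳ-≤ p 0≤q)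

*-nonNeg : ∀ {p q} → 0ℚ ≤ p → 0ℚ ≤ q → 0ℚ ≤ p * q
*-nonNeg {p} {q} 0≤p 0≤q = nonNegative⁻¹ (p * q) {{nonNeg*nonNeg⇒nonNeg p {{nonNegative 0≤p}} q {{nonNegative 0≤q}}}}

p*[q+r]≡r⇒p≤1 : ∀ {p q r} → 0ℚ < q → 0ℚ ≤ r → p * (q + r) ≡ r → p ≤ 1ℚ
p*[q+r]≡r⇒p≤1 {p} {q} {r} 0<q 0≤r eq = *-cancelʳ-≤-pos (q + r) {{q+r-pos}} (begin
  p * (q + r)   ≡⟨ eq ⟩
  r             ≤⟨ p≤p+q r (<⇒≤ 0<q) ⟩
  r + q         ≡⟨ +-comm r q ⟩
  q + r         ≡⟨ *-identityˡ (q + r) ⟨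
  1ℚ * (q + r)  ∎)
  where
  open ≤-Reasoning
  q+r-pos = pos+nonNeg⇒pos q {{positive 0<q}} r {{nonNegative 0≤r}}

p*[q+r]≡r⇒p*q≤r : ∀ {p q r} → 0ℚ ≤ p → 0ℚ ≤ r → p * (q + r) ≡ r → p * q ≤ r
p*[q+r]≡r⇒p*q≤r {p} {q} {r} 0≤p 0≤r eq = begin
  p * q          ≤⟨ p≤p+q (p * q) (*-nonNeg 0≤p 0≤r) ⟩
  p * q + p * r  ≡⟨ *-distribˡ-+ p q r ⟨
  p * (q + r)    ≡⟨ eq ⟩
  r              ∎
  where open ≤-Reasoning

p*t≤1 : ∀ {p λ' t f g} → 0ℚ < f → 0ℚ ≤ λ' → 0ℚ ≤ t →
        p * f ≤ λ' * g → λ' * t * (f + g) ≤ f → p * t ≤ 1ℚ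
p*t≤1 {p} {λ'} {t} {f} {g} 0<f 0≤λ 0≤t pf≤λg λt[f+g]≤f = *-cancelʳ-≤-pos f {{positive 0<f}} (begin
  p * t * f                    ≡⟨ solve 3 (λ p t f → p :* t :* f := p :* f :* t) refl p t f ⟩
  p * f * t                    ≤⟨ *-monoʳ-≤-nonNeg t {{nonNegative 0≤t}} pf≤λg ⟩
  λ' * g * t                   ≤⟨ p≤p+q (λ' * g * t) (*-nonNeg (*-nonNeg 0≤λ (<⇒≤ 0<f)) 0≤t) ⟩
  λ' * g * t + λ' * f * t      ≡⟨ solve 4 (λ l t f g → l :* g :* t :+ l :* f :* t := l :* t :* (f :+ g)) refl λ' t f g ⟩
  λ' * t * (f + g)             ≤⟨ λt[f+g]≤f ⟩
  f                            ≡⟨ *-identityˡ f ⟨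
  1ℚ * f                       ∎)
  where
  open ≤-Reasoning
  open +-*-Solver

p*p*t≤1 : ∀ {p t} → 0ℚ ≤ p → p ≤ 1ℚ → p * t ≤ 1ℚ → p * p * t ≤ 1ℚ
p*p*t≤1 {p} {t} 0≤p p≤1 pt≤1 = begin
  p * p * t    ≡⟨ *-assoc p p t ⟩
  p * (p * t)  ≤⟨ *-monoˡ-≤-nonNeg p {{nonNegative 0≤p}} pt≤1 ⟩
  p * 1ℚ       ≡⟨ *-identityʳ p ⟩
  p            ≤⟨ p≤1 ⟩
  1ℚ           ∎
  where open ≤-Reasoning

if-mono-≤ : ∀ b {r s} → (b ≡ true → r ≤ s) → (if b then r else 0ℚ) ≤ (if b then s else 0ℚ)
if-mono-≤ true  r≤s = r≤s refl
if-mono-≤ false _   = ≤-refl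

if-nonNeg : ∀ b {r} → 0ℚ ≤ r → 0ℚ ≤ (if b then r else 0ℚ)
if-nonNeg true  0≤r = 0≤r
if-nonNeg false _   = ≤-refl

if-*ʳ : ∀ b r c → (if b then r else 0ℚ) * c ≡ (if b then r * c else 0ℚ)
if-*ʳ true  r c = refl
if-*ʳ false r c = *-zeroˡ c

*-indicator : ∀ w b → w * (if b then 1ℚ else 0ℚ) ≡ (if b then w else 0ℚ)
*-indicator w true  = *-identityʳ w
*-indicator w false = *-zeroʳ w

-- Finite sums, expectations and probabilities

Σ-cong : ∀ m {f g : Fin m → ℚ} → (∀ j → f j ≡ g j) → Σ m f ≡ Σ m g
Σ-cong ℕ.zero  f≗g = refl
Σ-cong (suc m) f≗g = cong₂ _+_ (f≗g zero) (Σ-cong m (f≗g ∘ Fin.suc))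

Σ-mono-≤ : ∀ m {f g : Fin m → ℚ} → (∀ j → f j ≤ g j) → Σ m f ≤ Σ m g
Σ-mono-≤ ℕ.zero  f≤g = ≤-refl
Σ-mono-≤ (suc m) f≤g = +-mono-≤ (f≤g zero) (Σ-mono-≤ m (f≤g ∘ Fin.suc))

Σ-distrib-+ : ∀ m (f g : Fin m → ℚ) → Σ m (λ j → f j + g j) ≡ Σ m f + Σ m g
Σ-distrib-+ ℕ.zero  f g = refl
Σ-distrib-+ (suc m) f g = trans (cong (_+_ (f zero + g zero)) (Σ-distrib-+ m (f ∘ Fin.suc) (g ∘ Fin.suc)))
                                (interchange (f zero) (g zero) _ _)

Σ-*ʳ : ∀ m (f : Fin m → ℚ) c → Σ m f * c ≡ Σ m (λ j → f j * c)
Σ-*ʳ ℕ.zero  f c = *-zeroˡ c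
Σ-*ʳ (suc m) f c = trans (*-distribʳ-+ c (f zero) _) (cong (_+_ (f zero * c)) (Σ-*ʳ m (f ∘ Fin.suc) c))

Σ-zero : ∀ m → Σ m (λ _ → 0ℚ) ≡ 0ℚ
Σ-zero ℕ.zero  = refl
Σ-zero (suc m) = trans (+-identityˡ _) (Σ-zero m)

module _ {N} (D : HashDist N) where

  Ex-cong : ∀ {φ ψ : (Fin N → Bool) → ℚ} → (∀ h → φ h ≡ ψ h) → Ex D φ ≡ Ex D ψ
  Ex-cong φ≗ψ = Σ-cong (m D) (λ j → cong (weight D j *_) (φ≗ψ (hash D j)))

  Ex-mono-≤ : ∀ {φ ψ : (Fin N → Bool) → ℚ} → (∀ h → φ h ≤ ψ h) → Ex D φ ≤ Ex D ψ
  Ex-mono-≤ φ≤ψ = Σ-mono-≤ (m D) (λ j → *-monoˡ-≤-nonNeg (weight D j) {{nonNegative (weight≥0 D j)}} (φ≤ψ (hash D j)))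

  Ex-zero : Ex D (λ _ → 0ℚ) ≡ 0ℚ
  Ex-zero = trans (Σ-cong (m D) (λ j → *-zeroʳ (weight D j))) (Σ-zero (m D))

  Ex-nonNeg : ∀ {φ : (Fin N → Bool) → ℚ} → (∀ h → 0ℚ ≤ φ h) → 0ℚ ≤ Ex D φ
  Ex-nonNeg {φ} 0≤φ = subst (_≤ Ex D φ) Ex-zero (Ex-mono-≤ 0≤φ)

  Ex-distrib-+ : ∀ (φ ψ : (Fin N → Bool) → ℚ) → Ex D (λ h → φ h + ψ h) ≡ Ex D φ + Ex D ψ
  Ex-distrib-+ φ ψ = trans (Σ-cong (m D) (λ j → *-distribˡ-+ (weight D j) _ _)) (Σ-distrib-+ (m D) _ _)

  Ex-*ʳ : ∀ (φ : (Fin N → Bool) → ℚ) c → Ex D φ * c ≡ Ex D (λ h → φ h * c)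
  Ex-*ʳ φ c = trans (Σ-*ʳ (m D) _ c) (Σ-cong (m D) (λ j → *-assoc (weight D j) _ c))

  Ex-indicator : ∀ (E : (Fin N → Bool) → Bool) → Ex D (λ h → if E h then 1ℚ else 0ℚ) ≡ Pr D E
  Ex-indicator E = Σ-cong (m D) (λ j → *-indicator (weight D j) (E (hash D j)))

  Pr-cong : ∀ {E E′ : (Fin N → Bool) → Bool} → (∀ h → E h ≡ E′ h) → Pr D E ≡ Pr D E′
  Pr-cong E≗E′ = Σ-cong (m D) (λ j → cong (if_then weight D j else 0ℚ) (E≗E′ (hash D j)))

  Pr-∧ : ∀ {λ'} → HasMarginal D λ' → PairwiseIndependent D →
         ∀ {i i′} → i ≢ i′ → Pr D (λ h → h i ∧ h i′) ≡ λ' * λ'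
  Pr-∧ {λ'} marginal independent {i} {i′} i≢i′ = begin
    Pr D (λ h → h i ∧ h i′)                                ≡⟨ Pr-cong (λ h → sym (cong₂ _∧_ (==ᵇ-true (h i)) (==ᵇ-true (h i′)))) ⟩
    Pr D (λ h → (h i ==ᵇ true) ∧ (h i′ ==ᵇ true))          ≡⟨ independent i i′ i≢i′ true true ⟩
    Pr D (λ h → h i ==ᵇ true) * Pr D (λ h → h i′ ==ᵇ true) ≡⟨ cong₂ _*_ (Pr-cong (λ h → ==ᵇ-true (h i))) (Pr-cong (λ h → ==ᵇ-true (h i′))) ⟩
    Pr D (λ h → h i) * Pr D (λ h → h i′)                   ≡⟨ cong₂ _*_ (marginal i) (marginal i′) ⟩
    λ' * λ'                                                ∎
    where
    open ≡-Reasoning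
    ==ᵇ-true : ∀ b → (b ==ᵇ true) ≡ b
    ==ᵇ-true true  = refl
    ==ᵇ-true false = refl

-- The stream, the pool and the item 1

module _ {n : ℕ} where

  private
    Stream = List (Fin (suc n))
    Hash = Fin (suc n) → Bool

  others : Stream → Stream
  others = filterᵇ (λ q → not (q =F zero))

  othersInPool : Hash → Stream → ℕ
  othersInPool h Q = length (others (pool h Q))

  length≡freq+others : ∀ (Q : Stream) → length Q ≡ freq Q zero ℕ.+ length (others Q)
  length≡freq+others []              = refl
  length≡freq+others (zero ∷ Q)      = cong suc (length≡freq+others Q)
  length≡freq+others (Fin.suc q ∷ Q) = trans (cong suc (length≡freq+others Q)) (sym (ℕ.+-suc _ _))

  freq-pool : ∀ {h : Hash} → h zero ≡ true → ∀ (Q : Stream) → freq (pool h Q) zero ≡ freq Q zero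
  freq-pool h0 []            = refl
  freq-pool h0 (zero ∷ Q)    rewrite h0 = cong suc (freq-pool h0 Q)
  freq-pool {h} h0 (Fin.suc q ∷ Q) with h (Fin.suc q)
  ... | true  = freq-pool h0 Q
  ... | false = freq-pool h0 Q

  length-pool : ∀ {h : Hash} → h zero ≡ true → ∀ (Q : Stream) → length (pool h Q) ≡ freq Q zero ℕ.+ othersInPool h Q
  length-pool {h} h0 Q = trans (length≡freq+others (pool h Q)) (cong (ℕ._+ othersInPool h Q) (freq-pool h0 Q))

  othersInPool-zero : ∀ (h : Hash) (Q : Stream) → othersInPool h (zero ∷ Q) ≡ othersInPool h Q
  othersInPool-zero h Q with h zero
  ... | true  = refl
  ... | false = refl

  othersInPool-suc : ∀ (h : Hash) q (Q : Stream) →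
    (if h zero then ℕtoℚ (othersInPool h (Fin.suc q ∷ Q)) else 0ℚ)
      ≡ (if h zero then ℕtoℚ (othersInPool h Q) else 0ℚ) + (if h zero ∧ h (Fin.suc q) then 1ℚ else 0ℚ)
  othersInPool-suc h q Q with h (Fin.suc q) | h zero
  ... | true  | true  = trans (ℕtoℚ-+ 1 (othersInPool h Q)) (+-comm 1ℚ (ℕtoℚ (othersInPool h Q)))
  ... | false | true  = sym (+-identityʳ _)
  ... | _     | false = sym (+-identityʳ 0ℚ)

  B₁≡ : ∀ (Q : Stream) (h : Hash) → B₁ Q h ≡ h zero ∧ any (_=F zero) Q
  B₁≡ [] h = sym (∧-zeroʳ (h zero))
  B₁≡ (zero ∷ Q) h with h zero in h0
  ... | true  = refl
  ... | false = trans (B₁≡ Q h) (cong (_∧ any (_=F zero) Q) h0)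
  B₁≡ (Fin.suc q ∷ Q) h with h (Fin.suc q)
  ... | true  = B₁≡ Q h
  ... | false = B₁≡ Q h

  any⇒0<freq : ∀ (Q : Stream) → any (_=F zero) Q ≡ true → 0 ℕ.< freq Q zero
  any⇒0<freq (zero ∷ Q)      _ = ℕ.s≤s ℕ.z≤n
  any⇒0<freq (Fin.suc q ∷ Q) p = any⇒0<freq Q p

  PrAgiven-nonNeg : ∀ (Q : Stream) (h : Hash) → 0ℚ ≤ PrAgiven Q h
  PrAgiven-nonNeg Q h = ratio-nonNeg (othersInPool h Q) (length (pool h Q))

  PrAgiven-* : ∀ (Q : Stream) (h : Hash) → h zero ≡ true →
    PrAgiven Q h * (ℕtoℚ (freq Q zero) + ℕtoℚ (othersInPool h Q)) ≡ ℕtoℚ (othersInPool h Q)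
  PrAgiven-* Q h h0 = begin
    PrAgiven Q h * (ℕtoℚ (freq Q zero) + ℕtoℚ (othersInPool h Q)) ≡⟨ cong (PrAgiven Q h *_) (ℕtoℚ-+ (freq Q zero) (othersInPool h Q)) ⟨
    PrAgiven Q h * ℕtoℚ (freq Q zero ℕ.+ othersInPool h Q)       ≡⟨ cong (λ k → PrAgiven Q h * ℕtoℚ k) (length-pool h0 Q) ⟨
    PrAgiven Q h * ℕtoℚ (length (pool h Q))                        ≡⟨ ratio-* (length-filter (λ q → T? (not (q =F zero))) (pool h Q)) ⟩
    ℕtoℚ (othersInPool h Q)                                        ∎
    where open ≡-Reasoning

-- Conditioning on B₁

condDiv-zeroˡ : ∀ y → condDiv 0ℚ y ≡ 0ℚ
condDiv-zeroˡ y with y ≟ 0ℚ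
... | yes _   = refl
... | no y≢0 = *-zeroˡ ((1/ y) {{≢-nonZero y≢0}})

condDiv-*-cancel : ∀ x {y} → 0ℚ < y → condDiv x y * y ≡ x
condDiv-*-cancel x {y} 0<y with y ≟ 0ℚ
... | yes refl = ⊥-elim (<-irrefl refl 0<y)
... | no y≢0  = trans (*-assoc x _ y) (trans (cong (x *_) (*-inverseˡ y {{≢-nonZero y≢0}})) (*-identityʳ x))

PrA∣B₁-absent : ∀ {n} (D : HashDist (suc n)) Q → any (_=F zero) Q ≡ false → PrA∣B₁ D Q ≡ 0ℚ
PrA∣B₁-absent D Q 1∉Q = begin
  condDiv (PrAandB₁ D Q) (Pr D (B₁ Q))  ≡⟨ cong (λ x → condDiv x (Pr D (B₁ Q))) PrAandB₁≡0 ⟩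
  condDiv 0ℚ (Pr D (B₁ Q))              ≡⟨ condDiv-zeroˡ (Pr D (B₁ Q)) ⟩
  0ℚ                                    ∎
  where
  open ≡-Reasoning
  B₁-false : ∀ h → B₁ Q h ≡ false
  B₁-false h = trans (B₁≡ Q h) (trans (cong (h zero ∧_) 1∉Q) (∧-zeroʳ (h zero)))
  PrAandB₁≡0 : PrAandB₁ D Q ≡ 0ℚ
  PrAandB₁≡0 = trans (Ex-cong D (λ h → cong (if_then PrAgiven Q h else 0ℚ) (B₁-false h))) (Ex-zero D)

module _ {n} (D : HashDist (suc n)) {λ'} (marginal : HasMarginal D λ') (independent : PairwiseIndependent D) where

  Ex-othersInPool : ∀ Q → Ex D (λ h → if h zero then ℕtoℚ (othersInPool h Q) else 0ℚ)
                          ≡ λ' * λ' * ℕtoℚ (length (others Q))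
  Ex-othersInPool [] = trans (Ex-cong D (λ h → if-eta (h zero))) (trans (Ex-zero D) (sym (*-zeroʳ (λ' * λ'))))
  Ex-othersInPool (zero ∷ Q) =
    trans (Ex-cong D (λ h → cong (λ k → if h zero then ℕtoℚ k else 0ℚ) (othersInPool-zero h Q))) (Ex-othersInPool Q)
  Ex-othersInPool (Fin.suc q ∷ Q) = begin
    Ex D (λ h → if h zero then ℕtoℚ (othersInPool h (Fin.suc q ∷ Q)) else 0ℚ)
      ≡⟨ Ex-cong D (λ h → othersInPool-suc h q Q) ⟩
    Ex D (λ h → (if h zero then ℕtoℚ (othersInPool h Q) else 0ℚ) + (if h zero ∧ h (Fin.suc q) then 1ℚ else 0ℚ))
      ≡⟨ Ex-distrib-+ D (λ h → if h zero then ℕtoℚ (othersInPool h Q) else 0ℚ) (λ h → if h zero ∧ h (Fin.suc q) then 1ℚ else 0ℚ) ⟩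
    Ex D (λ h → if h zero then ℕtoℚ (othersInPool h Q) else 0ℚ) + Ex D (λ h → if h zero ∧ h (Fin.suc q) then 1ℚ else 0ℚ)
      ≡⟨ cong₂ _+_ (Ex-othersInPool Q) (trans (Ex-indicator D (λ h → h zero ∧ h (Fin.suc q))) (Pr-∧ D marginal independent {zero} {Fin.suc q} (λ ()))) ⟩
    λ² * G + λ²
      ≡⟨ cong (_+_ (λ² * G)) (*-identityʳ λ²) ⟨
    λ² * G + λ² * 1ℚ
      ≡⟨ *-distribˡ-+ λ² G 1ℚ ⟨
    λ² * (G + 1ℚ)
      ≡⟨ cong (λ² *_) (trans (+-comm G 1ℚ) (sym (ℕtoℚ-+ 1 (length (others Q))))) ⟩
    λ² * ℕtoℚ (suc (length (others Q)))
      ∎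
    where
    open ≡-Reasoning
    λ² = λ' * λ'
    G = ℕtoℚ (length (others Q))

module OneInStream {n} (D : HashDist (suc n)) {λ'} (0<λ : 0ℚ < λ')
                   (marginal : HasMarginal D λ') (independent : PairwiseIndependent D)
                   (Q : List (Fin (suc n))) (1∈Q : any (_=F zero) Q ≡ true) where

  F G : ℚ
  F = ℕtoℚ (freq Q zero)
  G = ℕtoℚ (length (others Q))

  0<F : 0ℚ < F
  0<F = ℕtoℚ-pos (any⇒0<freq Q 1∈Q)

  B₁≡h[1] : ∀ h → B₁ Q h ≡ h zero
  B₁≡h[1] h = trans (B₁≡ Q h) (trans (cong (h zero ∧_) 1∈Q) (∧-identityʳ (h zero)))

  Pr-B₁ : Pr D (B₁ Q) ≡ λ'
  Pr-B₁ = trans (Pr-cong D B₁≡h[1]) (marginal zero)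

  PrAandB₁≡ : PrAandB₁ D Q ≡ Ex D (λ h → if h zero then PrAgiven Q h else 0ℚ)
  PrAandB₁≡ = Ex-cong D (λ h → cong (if_then PrAgiven Q h else 0ℚ) (B₁≡h[1] h))

  PrAandB₁-nonNeg : 0ℚ ≤ PrAandB₁ D Q
  PrAandB₁-nonNeg = Ex-nonNeg D (λ h → if-nonNeg (B₁ Q h) (PrAgiven-nonNeg Q h))

  PrAandB₁≤λ : PrAandB₁ D Q ≤ λ'
  PrAandB₁≤λ = begin
    PrAandB₁ D Q                                          ≡⟨ PrAandB₁≡ ⟩
    Ex D (λ h → if h zero then PrAgiven Q h else 0ℚ)      ≤⟨ Ex-mono-≤ D (λ h → if-mono-≤ (h zero) (PrAgiven≤1 h)) ⟩
    Ex D (λ h → if h zero then 1ℚ else 0ℚ)                ≡⟨ Ex-indicator D (λ h → h zero) ⟩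
    Pr D (λ h → h zero)                                   ≡⟨ marginal zero ⟩
    λ'                                                    ∎
    where
    open ≤-Reasoning
    PrAgiven≤1 : ∀ h → h zero ≡ true → PrAgiven Q h ≤ 1ℚ
    PrAgiven≤1 h h[1] = p*[q+r]≡r⇒p≤1 0<F (ℕtoℚ-nonNeg (othersInPool h Q)) (PrAgiven-* Q h h[1])

  PrAandB₁*F≤ : PrAandB₁ D Q * F ≤ λ' * λ' * G
  PrAandB₁*F≤ = begin
    PrAandB₁ D Q * F                                                 ≡⟨ cong (_* F) PrAandB₁≡ ⟩
    Ex D (λ h → if h zero then PrAgiven Q h else 0ℚ) * F             ≡⟨ Ex-*ʳ D (λ h → if h zero then PrAgiven Q h else 0ℚ) F ⟩
    Ex D (λ h → (if h zero then PrAgiven Q h else 0ℚ) * F)           ≡⟨ Ex-cong D (λ h → if-*ʳ (h zero) (PrAgiven Q h) F) ⟩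
    Ex D (λ h → if h zero then PrAgiven Q h * F else 0ℚ)             ≤⟨ Ex-mono-≤ D (λ h → if-mono-≤ (h zero) (PrAgiven*F≤ h)) ⟩
    Ex D (λ h → if h zero then ℕtoℚ (othersInPool h Q) else 0ℚ)      ≡⟨ Ex-othersInPool D marginal independent Q ⟩
    λ' * λ' * G                                                      ∎
    where
    open ≤-Reasoning
    PrAgiven*F≤ : ∀ h → h zero ≡ true → PrAgiven Q h * F ≤ ℕtoℚ (othersInPool h Q)
    PrAgiven*F≤ h h[1] = p*[q+r]≡r⇒p*q≤r (PrAgiven-nonNeg Q h) (ℕtoℚ-nonNeg (othersInPool h Q)) (PrAgiven-* Q h h[1])

  PrA∣B₁*λ : PrA∣B₁ D Q * λ' ≡ PrAandB₁ D Q
  PrA∣B₁*λ = trans (cong (PrA∣B₁ D Q *_) (sym Pr-B₁)) (condDiv-*-cancel _ (subst (0ℚ <_) (sym Pr-B₁) 0<λ))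

  PrA∣B₁-nonNeg : 0ℚ ≤ PrA∣B₁ D Q
  PrA∣B₁-nonNeg = *-cancelʳ-≤-pos λ' {{positive 0<λ}}
    (subst₂ _≤_ (sym (*-zeroˡ λ')) (sym PrA∣B₁*λ) PrAandB₁-nonNeg)

  PrA∣B₁≤1 : PrA∣B₁ D Q ≤ 1ℚ
  PrA∣B₁≤1 = *-cancelʳ-≤-pos λ' {{positive 0<λ}}
    (subst₂ _≤_ (sym PrA∣B₁*λ) (sym (*-identityˡ λ')) PrAandB₁≤λ)

  PrA∣B₁*F≤λ*G : PrA∣B₁ D Q * F ≤ λ' * G
  PrA∣B₁*F≤λ*G = *-cancelʳ-≤-pos λ' {{positive 0<λ}} (begin
    PrA∣B₁ D Q * F * λ'  ≡⟨ solve 3 (λ p f l → p :* f :* l := p :* l :* f) refl (PrA∣B₁ D Q) F λ' ⟩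
    PrA∣B₁ D Q * λ' * F  ≡⟨ cong (_* F) PrA∣B₁*λ ⟩
    PrAandB₁ D Q * F     ≤⟨ PrAandB₁*F≤ ⟩
    λ' * λ' * G          ≡⟨ solve 2 (λ l g → l :* l :* g := l :* g :* l) refl λ' G ⟩
    λ' * G * λ'          ∎)
    where
    open ≤-Reasoning
    open +-*-Solver

mainTheorem5 : (n : ℕ) (Q : List (Fin (suc n))) (λ' T : ℚ) (D : HashDist (suc n)) →
    0ℚ < λ' → λ' ≤ 1ℚ → 0ℚ < T →
    HasMarginal D λ' → PairwiseIndependent D →
    λ' * T * ℕtoℚ (length Q) ≤ ℕtoℚ (freq Q zero) →
    PrA∣B₁ D Q * PrA∣B₁ D Q * T ≤ (+ 4) / 1
mainTheorem5 n Q λ' T D 0<λ _ 0<T marginal independent λTK≤F with any (_=F zero) Q in occurs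
... | false = subst (λ p → p * p * T ≤ (+ 4) / 1) (sym (PrA∣B₁-absent D Q occurs))
                    (≤-trans (≤-reflexive (trans (cong (_* T) (*-zeroˡ 0ℚ)) (*-zeroˡ T))) (≤ᵇ⇒≤ tt))
... | true  = ≤-trans (p*p*t≤1 PrA∣B₁-nonNeg PrA∣B₁≤1 P*T≤1) (≤ᵇ⇒≤ tt)
  where
  open OneInStream D 0<λ marginal independent Q occurs
  λT[F+G]≤F : λ' * T * (F + G) ≤ F
  λT[F+G]≤F = subst (λ k → λ' * T * k ≤ F)
    (trans (cong ℕtoℚ (length≡freq+others Q)) (ℕtoℚ-+ (freq Q zero) (length (others Q)))) λTK≤F
  P*T≤1 : PrA∣B₁ D Q * T ≤ 1ℚ
  P*T≤1 = p*t≤1 {p = PrA∣B₁ D Q} 0<F (<⇒≤ 0<λ) (<⇒≤ 0<T) PrA∣B₁*F≤λ*G λT[F+G]≤F
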